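{- Let $n\ge 2$, let $w_0\in S_n$ be the longest permutation $w_0(k)=n+1-k$, and let $V$ be the poset isomorphism from circular permutations of $S_n$ to admitted vectors. For every circular permutation $\sigma$ and all $1\le i<j\le n$: (1) $V(\sigma^{ -1})_{ij}=j-i-1-V(\sigma)_{ij}$; (2) $V(w_0\circ\sigma\circ w_0)_{ij}=j-i-1-V(\sigma)_{n+1-j,\,n+1-i}$. Consequently $u\mapsto v$ with $v_{ij}=j-i-1-u_{ij}$, and $u\mapsto v$ with $v_{ij}=j-i-1-u_{n+1-j,n+1-i}$, are anti-automorphisms of the poset of admitted vectors.
   Context: Permutations $w\in S_n$ are viewed as words on $\{1,\dots,n\}$; a circular permutation is an $n$-cycle, $(w)$ denoting the cycle $w_1\mapsto\cdots\mapsto w_n\mapsto w_1$. For $i<j$, $\gamma_{ij}(w)=1$ if $j$ appears before $i$ in $w$ and $0$ otherwise. $T=\{(i,j):1\le i<j\le n\}$; $v\in\mathbb N^T$ is admitted if $v_{i,i+1}=0$ and $v_{ij}+v_{jk}\le v_{ik}\le v_{ij}+v_{jk}+1$ for all $i<j<k$, ordered componentwise. The map $V$ is $V((w))_{ij}=-\gamma_{ij}(w)+\sum_{i\le k<j}\gamma_{k,k+1}(w)$; it is well defined and is an order isomorphism when circular permutations are ordered by the reflexive transitive closure of $(w)\to(w')$, where $w$ has a circular factor $sr$ with $s>r+1$ (a contiguous factor of a cyclic rotation of $w$) and $w'$ is obtained by replacing it with $rs$. The maps $\sigma\mapsto\sigma^{ -1}$ and $\sigma\mapsto w_0\sigma w_0$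 are anti-automorphisms of this poset. -}

module Defs where

open import Data.Nat using (ℕ; zero; suc; _+_; _∸_; _≤_; _<_; _≟_)
open import Data.Integer as ℤ using (ℤ; +_)
open import Data.List using (List; []; _∷_; map; upTo)
open import Data.Nat.ListAction using (sum)
open import Data.List.Relation.Binary.Permutation.Propositional using (_↭_)
open import Data.List.Membership.DecPropositional _≟_ using (_∈?_)
open import Data.Bool using (if_then_else_)
open import Data.Product using (Σ; _×_)
open import Relation.Nullary.Decidable using (⌊_⌋)
open import Relation.Binary.PropositionalEquality using (_≡_)

-- Letters are the naturals 1..n (1-based, as in the paper).
range : ℕ → List ℕ
range n = map suc (upTo n)

IsWord : ℕ → List ℕ → Set
IsWord n w = w ↭ range n

nextAfter : ℕ → List ℕ → ℕ → ℕ
nextAfter h [] x = x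
nextAfter h (a ∷ []) x = if ⌊ a ≟ x ⌋ then h else x
nextAfter h (a ∷ b ∷ rest) x = if ⌊ a ≟ x ⌋ then b else nextAfter h (b ∷ rest) x

-- cyc w : the circular permutation (w) = (w₁ ↦ w₂ ↦ … ↦ wₙ ↦ w₁), as a map
cyc : List ℕ → ℕ → ℕ
cyc [] x = x
cyc (h ∷ t) x = nextAfter h (h ∷ t) x

-- γ i j w = 1 if j appears before i in w, 0 otherwise
γ : ℕ → ℕ → List ℕ → ℕ
γ i j [] = 0
γ i j (x ∷ xs) =
  if ⌊ x ≟ j ⌋ then (if ⌊ i ∈? xs ⌋ then 1 else 0)
  else (if ⌊ x ≟ i ⌋ then 0 else γ i j xs)

interval : ℕ → ℕ → List ℕ
interval i j = map (λ k → i + k) (upTo (j ∸ i))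

V : List ℕ → ℕ → ℕ → ℤ
V w i j = ℤ.- (+ γ i j w) ℤ.+ + sum (map (λ k → γ k (suc k) w) (interval i j))

w₀ : ℕ → ℕ → ℕ
w₀ n k = suc n ∸ k

-- vectors indexed by T = {(i,j) : 1 ≤ i < j ≤ n}; entries outside T are ignored
Vect : Set
Vect = ℕ → ℕ → ℤ

InT : ℕ → ℕ → ℕ → Set
InT n i j = 1 ≤ i × i < j × j ≤ n

Admitted : ℕ → Vect → Set
Admitted n v =
  (∀ i j → InT n i j → + 0 ℤ.≤ v i j) ×
  (∀ i → InT n i (suc i) → v i (suc i) ≡ + 0) ×
  (∀ i j k → 1 ≤ i → i < j → j < k → k ≤ n →
     (v i j ℤ.+ v j k ℤ.≤ v i k) × (v i k ℤ.≤ v i j ℤ.+ v j k ℤ.+ + 1))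

Leq : ℕ → Vect → Vect → Set
Leq n u v = ∀ i j → InT n i j → u i j ℤ.≤ v i j

EqT : ℕ → Vect → Vect → Set
EqT n u v = ∀ i j → InT n i j → u i j ≡ v i j

-- φ is an anti-automorphism of the poset of admitted vectors:
-- maps admitted to admitted, surjective onto admitted vectors, and
-- u ≤ v ⇔ φ v ≤ φ u (order-reversing and order-reflecting, hence injective).
IsAntiAutomorphism : ℕ → (Vect → Vect) → Set
IsAntiAutomorphism n φ =
  (∀ u → Admitted n u → Admitted n (φ u)) ×
  (∀ u v → Admitted n u → Admitted n v →
     (Leq n u v → Leq n (φ v) (φ u)) × (Leq n (φ v) (φ u) → Leq n u v)) ×
  (∀ v → Admitted n v → Σ Vect (λ u → Admitted n u × EqT n (φ u) v))

flipV : Vect → Vect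
flipV u i j = + j ℤ.- + i ℤ.- + 1 ℤ.- u i j

flipW₀ : ℕ → Vect → Vect
flipW₀ n u i j = + j ℤ.- + i ℤ.- + 1 ℤ.- u (w₀ n j) (w₀ n i)

{-# OPTIONS --safe #-}
module Submission where

-- Write w = a₀ a₁ … aₙ₋₁ and let p t be the position in w′ of aₜ (of w₀ aₜ in the conjugate
-- case). If (w′) = (w)⁻¹ then p t ≡ p 0 − t (mod n); if (w′) = w₀ (w) w₀ then p t ≡ p 0 + t
-- (mod n). Comparing positions, for letters a ≠ b one gets γ_ab(w′) + γ_ab(w) = 1 + M a − M b
-- (resp. γ_ab(w′) + γ_{w₀b,w₀a}(w) = 1 + M b − M a), where M x records whether the residue
-- of x has wrapped around modulo n. Summed over the adjacent pairs (k, k+1) with i ≤ k < j the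
-- M-terms telescope, and subtracting the identity for the pair (i, j) itself leaves
-- V(w′)_ij + V(w)_ij = j − i − 1 (the conjugate case also reverses the sum, k ↦ w₀ k).
-- For the anti-automorphisms: the triangle inequalities bound admitted entries by j − i − 1, so
-- u ↦ j − i − 1 − u is an order-reversing involution of admitted vectors, and flipW₀ is that
-- map composed with the order-preserving involution u ↦ u_{w₀ j, w₀ i}.

open import Defs
open import Data.Product using (_×_; _,_; proj₁; proj₂)
open import Data.Sum using (_⊎_; inj₁; inj₂)
open import Function using (id; _∘_)
open import Relation.Binary.PropositionalEquality

module LongestPermutation where
  open import Data.Nat
  open import Data.Nat.Properties
  open import Data.Nat.Tactic.RingSolver using (solve-∀)

  w₀-suc : ∀ {n x} → x ≤ n → w₀ n x ≡ suc (n ∸ x)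
  w₀-suc x≤n = +-∸-assoc 1 x≤n

  w₀-involutive : ∀ {n x} → x ≤ n → w₀ n (w₀ n x) ≡ x
  w₀-involutive x≤n = m∸[m∸n]≡n (m≤n⇒m≤1+n x≤n)

  w₀-positive : ∀ {n x} → x ≤ n → 1 ≤ w₀ n x
  w₀-positive x≤n rewrite w₀-suc x≤n = s≤s z≤n

  w₀-≤ : ∀ {n x} → 1 ≤ x → w₀ n x ≤ n
  w₀-≤ {n} {suc x} _ = m∸n≤m n x

  w₀-reverses-< : ∀ {n x y} → x < y → y ≤ n → w₀ n y < w₀ n x
  w₀-reverses-< {n} x<y y≤n rewrite w₀-suc y≤n | w₀-suc (≤-trans (<⇒≤ x<y) y≤n) =
    s≤s (∸-monoʳ-< x<y y≤n)

  w₀-injective : ∀ {n x y} → x ≤ n → y ≤ n → w₀ n x ≡ w₀ n y → x ≡ y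
  w₀-injective x≤n y≤n e = trans (sym (w₀-involutive x≤n)) (trans (cong (w₀ _) e) (w₀-involutive y≤n))

  InT-w₀ : ∀ {n i j} → InT n i j → InT n (w₀ n j) (w₀ n i)
  InT-w₀ (1≤i , i<j , j≤n) = w₀-positive j≤n , w₀-reverses-< i<j j≤n , w₀-≤ 1≤i

  suc[m+n]∸m≡1+n : ∀ m n → suc (m + n) ∸ m ≡ suc n
  suc[m+n]∸m≡1+n m n = trans (cong (_∸ m) (sym (+-suc m n))) (m+n∸m≡n m (suc n))

  w₀-∸ : ∀ {n i j} → i ≤ j → j ≤ n → w₀ n i ∸ w₀ n j ≡ j ∸ i
  w₀-∸ {n} {i} {j} i≤j j≤n
    with L , refl ← m≤n⇒∃[o]m+o≡n i≤j
    with e , refl ← m≤n⇒∃[o]m+o≡n j≤n =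
    trans (cong₂ _∸_ (trans (cong (λ m → suc m ∸ i) (+-assoc i L e)) (suc[m+n]∸m≡1+n i (L + e)))
                     (suc[m+n]∸m≡1+n (i + L) e))
          (trans (m+n∸n≡m L e) (sym (m+n∸m≡n i L)))

  w₀-shift : ∀ {n i j k} → i ≤ j → j ≤ n → suc k ≤ j ∸ i →
             w₀ n (suc (i + k)) ≡ w₀ n j + (j ∸ i ∸ suc k)
  w₀-shift {n} {i} {j} {k} i≤j j≤n k<j-i
    with L , refl ← m≤n⇒∃[o]m+o≡n i≤j
    with e , refl ← m≤n⇒∃[o]m+o≡n j≤n
    with r , refl ← m≤n⇒∃[o]m+o≡n (subst (suc k ≤_) (m+n∸m≡n i L) k<j-i) =
    trans (cong (_∸ (i + k)) (rearrange i k r e))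
          (trans (m+n∸m≡n (i + k) (suc (e + r)))
                 (sym (cong₂ _+_ (suc[m+n]∸m≡1+n (i + (suc k + r)) e)
                                 (trans (cong (_∸ suc k) (m+n∸m≡n i _)) (m+n∸m≡n (suc k) r)))))
    where
    rearrange : ∀ i k r e → i + (suc k + r) + e ≡ i + k + suc (e + r)
    rearrange = solve-∀

open LongestPermutation

module AdmittedVectors where
  open import Data.Nat as ℕ using (ℕ; suc)
  import Data.Nat.Properties as ℕ
  open import Data.Integer hiding (suc)
  open import Data.Integer.Properties
  open import Data.Integer.Tactic.RingSolver using (solve-∀)

  gap : ℕ → ℕ → ℤ
  gap i j = + j - + i - + 1

  gap-suc : ∀ i → gap i (suc i) ≡ + 0
  gap-suc i = trans (cong (λ z → z - + i - + 1) (pos-+ 1 i)) (1+x-x-1≡0 (+ i))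
    where
    1+x-x-1≡0 : ∀ x → + 1 + x - x - + 1 ≡ + 0
    1+x-x-1≡0 = solve-∀

  gap-step : ∀ i j → gap i j + + 1 ≡ gap i (suc j)
  gap-step i j = trans (y-x-1+1≡1+y-x-1 (+ i) (+ j)) (cong (λ z → z - + i - + 1) (sym (pos-+ 1 j)))
    where
    y-x-1+1≡1+y-x-1 : ∀ x y → y - x - + 1 + + 1 ≡ + 1 + y - x - + 1
    y-x-1+1≡1+y-x-1 = solve-∀

  sub-cancelˡ-≤ : ∀ c {x y} → c - y ≤ c - x → x ≤ y
  sub-cancelˡ-≤ c {x} {y} h = neg-cancel-≤ (subst₂ _≤_ (-c+[c-x]≡-x c y) (-c+[c-x]≡-x c x) (+-monoʳ-≤ (- c) h))
    where
    -c+[c-x]≡-x : ∀ c x → - c + (c - x) ≡ - x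
    -c+[c-x]≡-x = solve-∀

  sub-monoʳ-≤ : ∀ c {x y} → x ≤ y → c - y ≤ c - x
  sub-monoʳ-≤ c h = +-monoʳ-≤ c (neg-mono-≤ h)

  admitted-≤-gap : ∀ {n u} → Admitted n u → ∀ i j → InT n i j → u i j ≤ gap i j
  admitted-≤-gap {n} {u} adm@(_ , adjacent , triangle) i (suc j) t@(1≤i , ℕ.s≤s i≤j , j<n)
    with ℕ.m≤n⇒m<n∨m≡n i≤j
  ... | inj₂ refl = ≤-reflexive (trans (adjacent i t) (sym (gap-suc i)))
  ... | inj₁ i<j = begin
    u i (suc j)                 ≤⟨ proj₂ (triangle i j (suc j) 1≤i i<j (ℕ.n<1+n j) j<n) ⟩
    u i j + u j (suc j) + + 1   ≡⟨ cong (λ z → u i j + z + + 1) u-adjacent ⟩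
    u i j + + 0 + + 1           ≡⟨ cong (_+ + 1) (+-identityʳ (u i j)) ⟩
    u i j + + 1                 ≤⟨ +-monoˡ-≤ (+ 1) (admitted-≤-gap adm i j (1≤i , i<j , ℕ.<⇒≤ j<n)) ⟩
    gap i j + + 1               ≡⟨ gap-step i j ⟩
    gap i (suc j)               ∎
    where
    open ≤-Reasoning
    u-adjacent : u j (suc j) ≡ + 0
    u-adjacent = adjacent j (ℕ.≤-trans 1≤i (ℕ.<⇒≤ i<j) , ℕ.n<1+n j , j<n)

  flipV-involutive : ∀ u i j → flipV (flipV u) i j ≡ u i j
  flipV-involutive u i j = c-[c-x]≡x (gap i j) (u i j)
    where
    c-[c-x]≡x : ∀ c x → c - (c - x) ≡ x
    c-[c-x]≡x = solve-∀

  flipV-admitted : ∀ {n u} → Admitted n u → Admitted n (flipV u)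
  flipV-admitted {n} {u} adm@(_ , adjacent , triangle) = nonneg , flip-adjacent , flip-triangle
    where
    nonneg : ∀ i j → InT n i j → + 0 ≤ flipV u i j
    nonneg i j t = i≤j⇒0≤j-i (admitted-≤-gap adm i j t)
    flip-adjacent : ∀ i → InT n i (suc i) → flipV u i (suc i) ≡ + 0
    flip-adjacent i t = trans (cong (λ z → gap i (suc i) - z) (adjacent i t)) (trans (+-identityʳ _) (gap-suc i))
    flip-triangle : ∀ i j k → 1 ℕ.≤ i → i ℕ.< j → j ℕ.< k → k ℕ.≤ n →
      (flipV u i j + flipV u j k ≤ flipV u i k) × (flipV u i k ≤ flipV u i j + flipV u j k + + 1)
    flip-triangle i j k 1≤i i<j j<k k≤n =
      subst (_≤ flipV u i k) (sym (lower (+ i) (+ j) (+ k) a b)) (sub-monoʳ-≤ (gap i k) (proj₂ tri)) ,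
      subst (flipV u i k ≤_) (sym (upper (+ i) (+ j) (+ k) a b)) (sub-monoʳ-≤ (gap i k) (proj₁ tri))
      where
      a b : ℤ
      a = u i j
      b = u j k
      tri : (a + b ≤ u i k) × (u i k ≤ a + b + + 1)
      tri = triangle i j k 1≤i i<j j<k k≤n
      lower : ∀ I J K a b → (J - I - + 1 - a) + (K - J - + 1 - b) ≡ (K - I - + 1) - (a + b + + 1)
      lower = solve-∀
      upper : ∀ I J K a b → (J - I - + 1 - a) + (K - J - + 1 - b) + + 1 ≡ (K - I - + 1) - (a + b)
      upper = solve-∀

  flipV-mono-≤ : ∀ {n u v} → Leq n u v → Leq n (flipV v) (flipV u)
  flipV-mono-≤ h i j t = sub-monoʳ-≤ (gap i j) (h i j t)

  flipV-cancel-≤ : ∀ {n u v} → Leq n (flipV v) (flipV u) → Leq n u v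
  flipV-cancel-≤ h i j t = sub-cancelˡ-≤ (gap i j) (h i j t)

  flipV-isAntiAutomorphism : ∀ n → IsAntiAutomorphism n flipV
  flipV-isAntiAutomorphism n =
    (λ u → flipV-admitted) ,
    (λ u v _ _ → flipV-mono-≤ , flipV-cancel-≤) ,
    (λ v adm → flipV v , flipV-admitted adm , λ i j _ → flipV-involutive v i j)

  reflect : ℕ → Vect → Vect
  reflect n u i j = u (w₀ n j) (w₀ n i)

  reflect-involutive : ∀ {n} u {i j} → InT n i j → reflect n (reflect n u) i j ≡ u i j
  reflect-involutive u (_ , i<j , j≤n) =
    cong₂ u (w₀-involutive (ℕ.≤-trans (ℕ.<⇒≤ i<j) j≤n)) (w₀-involutive j≤n)

  reflect-mono-≤ : ∀ {n u v} → Leq n u v → Leq n (reflect n u) (reflect n v)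
  reflect-mono-≤ h i j t = h _ _ (InT-w₀ t)

  reflect-cancel-≤ : ∀ {n u v} → Leq n (reflect n u) (reflect n v) → Leq n u v
  reflect-cancel-≤ {u = u} {v} h i j t =
    subst₂ _≤_ (reflect-involutive u t) (reflect-involutive v t) (reflect-mono-≤ h i j t)

  reflect-admitted : ∀ {n u} → Admitted n u → Admitted n (reflect n u)
  reflect-admitted {n} {u} (nonneg , adjacent , triangle) = reflect-nonneg , reflect-adjacent , reflect-triangle
    where
    reflect-nonneg : ∀ i j → InT n i j → + 0 ≤ reflect n u i j
    reflect-nonneg i j t = nonneg _ _ (InT-w₀ t)
    reflect-adjacent : ∀ i → InT n i (suc i) → reflect n u i (suc i) ≡ + 0
    reflect-adjacent i (1≤i , _ , i<n) =
      trans (cong (u (n ℕ.∸ i)) (w₀-suc (ℕ.<⇒≤ i<n)))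
            (adjacent (n ℕ.∸ i)
              (w₀-positive i<n , ℕ.n<1+n _ , subst (ℕ._≤ n) (w₀-suc (ℕ.<⇒≤ i<n)) (w₀-≤ 1≤i)))
    reflect-triangle : ∀ i j k → 1 ℕ.≤ i → i ℕ.< j → j ℕ.< k → k ℕ.≤ n →
      (reflect n u i j + reflect n u j k ≤ reflect n u i k) ×
      (reflect n u i k ≤ reflect n u i j + reflect n u j k + + 1)
    reflect-triangle i j k 1≤i i<j j<k k≤n =
      subst (_≤ reflect n u i k) (+-comm (u (w₀ n k) (w₀ n j)) _) (proj₁ tri) ,
      subst (λ z → reflect n u i k ≤ z + + 1) (+-comm (u (w₀ n k) (w₀ n j)) _) (proj₂ tri)
      where
      tri : (u (w₀ n k) (w₀ n j) + u (w₀ n j) (w₀ n i) ≤ u (w₀ n k) (w₀ n i)) ×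
            (u (w₀ n k) (w₀ n i) ≤ u (w₀ n k) (w₀ n j) + u (w₀ n j) (w₀ n i) + + 1)
      tri = triangle (w₀ n k) (w₀ n j) (w₀ n i) (w₀-positive k≤n) (w₀-reverses-< j<k k≤n)
              (w₀-reverses-< i<j (ℕ.<⇒≤ (ℕ.<-≤-trans j<k k≤n))) (w₀-≤ 1≤i)

  -- flipW₀ n u is definitionally flipV (reflect n u).
  flipW₀-isAntiAutomorphism : ∀ n → IsAntiAutomorphism n (flipW₀ n)
  flipW₀-isAntiAutomorphism n =
    (λ u adm → flipV-admitted (reflect-admitted adm)) ,
    (λ u v _ _ → (λ h → flipV-mono-≤ (reflect-mono-≤ h)) , (λ h → reflect-cancel-≤ (flipV-cancel-≤ h))) ,
    (λ v adm → reflect n (flipV v) , reflect-admitted (flipV-admitted adm) , surjective v)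
    where
    surjective : ∀ v i j → InT n i j → flipW₀ n (reflect n (flipV v)) i j ≡ v i j
    surjective v i j t =
      trans (cong (λ z → gap i j - z) (reflect-involutive (flipV v) t)) (flipV-involutive v i j)


open AdmittedVectors using (flipV-isAntiAutomorphism; flipW₀-isAntiAutomorphism)

open import Data.Nat
open import Data.Nat.Properties
open import Data.Nat.ListAction using (sum)
open import Algebra.Properties.CommutativeSemigroup +-commutativeSemigroup
  using (interchange; xy∙z≈y∙xz; x∙yz≈y∙xz; xy∙z≈xz∙y)
open import Data.Bool using (if_then_else_)
open import Data.Empty using (⊥-elim)
open import Relation.Nullary using (yes; no)
open import Relation.Nullary.Decidable using (⌊_⌋)
open import Relation.Binary.Definitions using (tri<; tri≈; tri>)
open import Data.List using (List; []; _∷_; map; applyUpTo; upTo; length)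
open import Data.List.Properties using (map-applyUpTo; length-map; length-upTo)
open import Data.List.Relation.Unary.Any using (here; there; tail)
import Data.List.Relation.Unary.All as All
open import Data.List.Relation.Unary.AllPairs using (_∷_)
open import Data.List.Relation.Unary.Unique.Propositional using (Unique)
import Data.List.Relation.Unary.Unique.Propositional.Properties as Unique
open import Data.List.Membership.Propositional using (_∈_)
open import Data.List.Membership.Propositional.Properties using (∈-map⁺; ∈-map⁻; ∈-upTo⁺; ∈-upTo⁻)
open import Data.List.Membership.DecPropositional _≟_ using (_∈?_)
open import Data.List.Relation.Binary.Permutation.Propositional using (↭-sym; ↭-trans; ↭⇒↭ₛ)
open import Data.List.Relation.Binary.Permutation.Propositional.Properties using (∈-resp-↭; ↭-length)
import Data.List.Relation.Binary.Permutation.Setoid.Properties as Permutation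

𝟙[_<_] : ℕ → ℕ → ℕ
𝟙[ zero  < suc b ] = 1
𝟙[ a     < zero  ] = 0
𝟙[ suc a < suc b ] = 𝟙[ a < b ]

<⇒𝟙≡1 : ∀ {a b} → a < b → 𝟙[ a < b ] ≡ 1
<⇒𝟙≡1 {zero}  {suc b} _         = refl
<⇒𝟙≡1 {suc a} {suc b} (s≤s a<b) = <⇒𝟙≡1 a<b

≥⇒𝟙≡0 : ∀ {a b} → b ≤ a → 𝟙[ a < b ] ≡ 0
≥⇒𝟙≡0 {zero}  {zero}  _         = refl
≥⇒𝟙≡0 {suc a} {zero}  _         = refl
≥⇒𝟙≡0 {suc a} {suc b} (s≤s b≤a) = ≥⇒𝟙≡0 b≤a

𝟙-+-cancelˡ : ∀ d a b → 𝟙[ d + a < d + b ] ≡ 𝟙[ a < b ]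
𝟙-+-cancelˡ zero    a b = refl
𝟙-+-cancelˡ (suc d) a b = 𝟙-+-cancelˡ d a b

𝟙-+-cancelʳ : ∀ d a b → 𝟙[ a + d < b + d ] ≡ 𝟙[ a < b ]
𝟙-+-cancelʳ d a b rewrite +-comm a d | +-comm b d = 𝟙-+-cancelˡ d a b

m+n≡o⇒m≤o : ∀ {m n o} → m + n ≡ o → m ≤ o
m+n≡o⇒m≤o {m} {n} e = subst (m ≤_) e (m≤m+n m n)

+-cross-< : ∀ {a b s t} → a + s ≡ b + t → t < s → a < b
+-cross-< {a} {b} {s} {t} e t<s = +-cancelʳ-< t a b (subst (a + t <_) e (+-monoʳ-< a t<s))

𝟙-swap : ∀ {s t ps pt} → ps + s ≡ pt + t → s ≢ t → 𝟙[ pt < ps ] + 𝟙[ t < s ] ≡ 1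
𝟙-swap {s} {t} e s≢t with <-cmp t s
... | tri< t<s _ _ rewrite ≥⇒𝟙≡0 (<⇒≤ (+-cross-< e t<s)) | <⇒𝟙≡1 t<s = refl
... | tri≈ _ t≡s _ = ⊥-elim (s≢t (sym t≡s))
... | tri> _ _ s<t rewrite <⇒𝟙≡1 (+-cross-< (sym e) s<t) | ≥⇒𝟙≡0 (<⇒≤ s<t) = refl

𝟙-trichotomy : ∀ {s t} → s ≢ t → 𝟙[ t < s ] + 𝟙[ s < t ] ≡ 1
𝟙-trichotomy {s} {t} s≢t = trans (+-comm 𝟙[ t < s ] _) (𝟙-swap (+-comm t s) s≢t)

-- Residues in [0, n): SuccMod n p q says q ≡ p + 1, SubMod n d t p says p ≡ d − t, and
-- AddMod n d t q says q ≡ d + t (mod n), each split on whether the reduction wraps around.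
SuccMod : ℕ → ℕ → ℕ → Set
SuccMod n p q = (suc p < n × q ≡ suc p) ⊎ (suc p ≡ n × q ≡ 0)

SubMod : ℕ → ℕ → ℕ → ℕ → Set
SubMod n d t p = (t ≤ d × p + t ≡ d) ⊎ (d < t × p + t ≡ d + n)

AddMod : ℕ → ℕ → ℕ → ℕ → Set
AddMod n d t q = (d + t < n × q ≡ d + t) ⊎ (n ≤ d + t × q + n ≡ d + t)

SubMod-suc : ∀ {n d t p q} → suc t < n → SubMod n d t p → SuccMod n q p → SubMod n d (suc t) q
SubMod-suc {d = d} {t} {q = q} _ (inj₁ (_ , p+t≡d)) (inj₁ (_ , refl)) =
  inj₁ (subst (suc t ≤_) q+1+t≡d (m≤n+m (suc t) q) , q+1+t≡d)
  where
  q+1+t≡d : q + suc t ≡ d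
  q+1+t≡d = trans (+-suc q t) p+t≡d
SubMod-suc {n} {d} {t} {q = q} _ (inj₁ (_ , refl)) (inj₂ (1+q≡n , refl)) =
  inj₂ (n<1+n t , trans (+-suc q t) (trans (cong (_+ t) 1+q≡n) (+-comm n t)))
SubMod-suc {t = t} {q = q} _ (inj₂ (d<t , p+t≡d+n)) (inj₁ (_ , refl)) =
  inj₂ (m<n⇒m<1+n d<t , trans (+-suc q t) p+t≡d+n)
SubMod-suc {n} {d} {t} 1+t<n (inj₂ (_ , t≡d+n)) (inj₂ (_ , refl)) =
  ⊥-elim (<-asym 1+t<n (s≤s (subst (n ≤_) (sym t≡d+n) (m≤n+m n d))))

AddMod-suc : ∀ {n d t p q} → d < n → suc t < n → AddMod n d t p → SuccMod n p q → AddMod n d (suc t) q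
AddMod-suc {n} {d} {t} _ _ (inj₁ (_ , refl)) (inj₁ (1+p<n , refl)) =
  inj₁ (subst (_< n) (sym (+-suc d t)) 1+p<n , sym (+-suc d t))
AddMod-suc {n} {d} {t} _ _ (inj₁ (_ , refl)) (inj₂ (1+p≡n , refl)) =
  inj₂ (≤-reflexive n≡d+1+t , n≡d+1+t)
  where
  n≡d+1+t : n ≡ d + suc t
  n≡d+1+t = trans (sym 1+p≡n) (sym (+-suc d t))
AddMod-suc {n} {d} {t} _ _ (inj₂ (n≤d+t , p+n≡d+t)) (inj₁ (_ , refl)) =
  inj₂ (subst (n ≤_) (sym (+-suc d t)) (m≤n⇒m≤1+n n≤d+t) , trans (cong suc p+n≡d+t) (sym (+-suc d t)))
AddMod-suc {n} {d} {t} d<n 1+t<n (inj₂ (_ , p+n≡d+t)) (inj₂ (1+p≡n , refl)) =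
  ⊥-elim (<-irrefl d+1+t≡n+n (+-mono-< d<n 1+t<n))
  where
  d+1+t≡n+n : d + suc t ≡ n + n
  d+1+t≡n+n = trans (+-suc d t) (trans (cong suc (sym p+n≡d+t)) (cong (_+ n) 1+p≡n))

SubMod-iterate : ∀ {n} (f : ℕ → ℕ) → (∀ t → suc t < n → SuccMod n (f (suc t)) (f t)) →
                 ∀ t → t < n → SubMod n (f 0) t (f t)
SubMod-iterate f step zero    _     = inj₁ (z≤n , +-identityʳ (f 0))
SubMod-iterate f step (suc t) 1+t<n =
  SubMod-suc 1+t<n (SubMod-iterate f step t (<-trans (n<1+n t) 1+t<n)) (step t 1+t<n)

AddMod-iterate : ∀ {n} (f : ℕ → ℕ) → (∀ t → t < n → f t < n) →
                 (∀ t → suc t < n → SuccMod n (f t) (f (suc t))) →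
                 ∀ t → t < n → AddMod n (f 0) t (f t)
AddMod-iterate f f<n step zero    0<n   =
  inj₁ (subst (_< _) (sym (+-identityʳ (f 0))) (f<n 0 0<n) , sym (+-identityʳ (f 0)))
AddMod-iterate f f<n step (suc t) 1+t<n =
  AddMod-suc (f<n 0 (≤-trans (s≤s z≤n) 1+t<n)) 1+t<n
             (AddMod-iterate f f<n step t (<-trans (n<1+n t) 1+t<n)) (step t 1+t<n)

SubMod-𝟙 : ∀ {n d s t ps pt} → s ≢ t → s < n → t < n → SubMod n d s ps → SubMod n d t pt →
           𝟙[ pt < ps ] + 𝟙[ t < s ] + 𝟙[ d < t ] ≡ 1 + 𝟙[ d < s ]
SubMod-𝟙 s≢t _ _ (inj₁ (s≤d , ps+s≡d)) (inj₁ (t≤d , pt+t≡d))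
  rewrite ≥⇒𝟙≡0 s≤d | ≥⇒𝟙≡0 t≤d =
  trans (+-identityʳ _) (𝟙-swap (trans ps+s≡d (sym pt+t≡d)) s≢t)
SubMod-𝟙 {ps = ps} {pt} s≢t s<n _ (inj₂ (d<s , ps+s≡d+n)) (inj₁ (t≤d , pt+t≡d))
  rewrite <⇒𝟙≡1 {pt} {ps} (≤-<-trans (m+n≡o⇒m≤o pt+t≡d) (+-cross-< (sym ps+s≡d+n) s<n))
        | <⇒𝟙≡1 (≤-<-trans t≤d d<s) | ≥⇒𝟙≡0 t≤d | <⇒𝟙≡1 d<s = refl
SubMod-𝟙 {ps = ps} {pt} s≢t _ t<n (inj₁ (s≤d , ps+s≡d)) (inj₂ (d<t , pt+t≡d+n))
  rewrite ≥⇒𝟙≡0 {pt} {ps} (<⇒≤ (≤-<-trans (m+n≡o⇒m≤o ps+s≡d) (+-cross-< (sym pt+t≡d+n) t<n)))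
        | ≥⇒𝟙≡0 (<⇒≤ (≤-<-trans s≤d d<t)) | <⇒𝟙≡1 d<t | ≥⇒𝟙≡0 s≤d = refl
SubMod-𝟙 s≢t _ _ (inj₂ (d<s , ps+s≡d+n)) (inj₂ (d<t , pt+t≡d+n))
  rewrite <⇒𝟙≡1 d<s | <⇒𝟙≡1 d<t =
  trans (+-comm _ 1) (cong suc (𝟙-swap (trans ps+s≡d+n (sym pt+t≡d+n)) s≢t))

AddMod-𝟙 : ∀ {n d s t qs qt} → s < n → t < n → AddMod n d s qs → AddMod n d t qt →
           𝟙[ qt < qs ] + 𝟙[ n < suc (d + s) ] ≡ 𝟙[ t < s ] + 𝟙[ n < suc (d + t) ]
AddMod-𝟙 {n} {d} {s} {t} _ _ (inj₁ (d+s<n , refl)) (inj₁ (d+t<n , refl))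
  rewrite ≥⇒𝟙≡0 {n} d+s<n | ≥⇒𝟙≡0 {n} d+t<n = cong (_+ 0) (𝟙-+-cancelˡ d t s)
AddMod-𝟙 {n} {d} {s} {t} {qs} {qt} _ _ (inj₂ (n≤d+s , qs+n≡d+s)) (inj₂ (n≤d+t , qt+n≡d+t))
  rewrite <⇒𝟙≡1 (s≤s n≤d+s) | <⇒𝟙≡1 (s≤s n≤d+t) =
  cong (_+ 1) (trans (sym (𝟙-+-cancelʳ n qt qs))
                     (trans (cong₂ 𝟙[_<_] qt+n≡d+t qs+n≡d+s) (𝟙-+-cancelˡ d t s)))
AddMod-𝟙 {n} {d} {s} {t} {qt = qt} _ t<n (inj₁ (d+s<n , refl)) (inj₂ (n≤d+t , qt+n≡d+t))
  rewrite <⇒𝟙≡1 {qt} (<-≤-trans (+-cross-< qt+n≡d+t t<n) (m≤m+n d s)) | ≥⇒𝟙≡0 {n} d+s<n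
        | ≥⇒𝟙≡0 {t} {s} (<⇒≤ (+-cancelˡ-< d s t (<-≤-trans d+s<n n≤d+t)))
        | <⇒𝟙≡1 (s≤s n≤d+t) = refl
AddMod-𝟙 {n} {d} {s} {t} {qs} s<n _ (inj₂ (n≤d+s , qs+n≡d+s)) (inj₁ (d+t<n , refl))
  rewrite ≥⇒𝟙≡0 {d + t} {qs} (<⇒≤ (<-≤-trans (+-cross-< qs+n≡d+s s<n) (m≤m+n d t)))
        | <⇒𝟙≡1 (s≤s n≤d+s)
        | <⇒𝟙≡1 (+-cancelˡ-< d t s (<-≤-trans d+t<n n≤d+s)) | ≥⇒𝟙≡0 {n} d+t<n = refl

sumTo : ℕ → (ℕ → ℕ) → ℕ
sumTo zero    f = 0
sumTo (suc L) f = f 0 + sumTo L (λ k → f (suc k))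

syntax sumTo L (λ k → e) = ∑[ k < L ] e

sum-applyUpTo : ∀ (f : ℕ → ℕ) L → sum (applyUpTo f L) ≡ ∑[ k < L ] f k
sum-applyUpTo f zero    = refl
sum-applyUpTo f (suc L) = cong (f 0 +_) (sum-applyUpTo (λ k → f (suc k)) L)

sum-interval : ∀ (f : ℕ → ℕ) i j → sum (map f (interval i j)) ≡ ∑[ k < j ∸ i ] f (i + k)
sum-interval f i j = begin
  sum (map f (map (i +_) (applyUpTo id (j ∸ i))))
    ≡⟨ cong (λ xs → sum (map f xs)) (map-applyUpTo id (i +_) (j ∸ i)) ⟩
  sum (map f (applyUpTo (i +_) (j ∸ i)))
    ≡⟨ cong sum (map-applyUpTo (i +_) f (j ∸ i)) ⟩
  sum (applyUpTo (λ k → f (i + k)) (j ∸ i))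
    ≡⟨ sum-applyUpTo (λ k → f (i + k)) (j ∸ i) ⟩
  ∑[ k < j ∸ i ] f (i + k) ∎
  where open ≡-Reasoning

∑-cong : ∀ L {f g : ℕ → ℕ} → (∀ k → k < L → f k ≡ g k) → ∑[ k < L ] f k ≡ ∑[ k < L ] g k
∑-cong zero    eq = refl
∑-cong (suc L) eq = cong₂ _+_ (eq 0 (s≤s z≤n)) (∑-cong L (λ k k<L → eq (suc k) (s≤s k<L)))

∑-distrib-+ : ∀ L (f g : ℕ → ℕ) → ∑[ k < L ] (f k + g k) ≡ ∑[ k < L ] f k + ∑[ k < L ] g k
∑-distrib-+ zero    f g = refl
∑-distrib-+ (suc L) f g = begin
  f 0 + g 0 + ∑[ k < L ] (f (suc k) + g (suc k))
    ≡⟨ cong (f 0 + g 0 +_) (∑-distrib-+ L (λ k → f (suc k)) (λ k → g (suc k))) ⟩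
  f 0 + g 0 + (∑[ k < L ] f (suc k) + ∑[ k < L ] g (suc k))
    ≡⟨ interchange (f 0) (g 0) _ _ ⟩
  f 0 + ∑[ k < L ] f (suc k) + (g 0 + ∑[ k < L ] g (suc k)) ∎
  where open ≡-Reasoning

∑-one : ∀ L → ∑[ k < L ] 1 ≡ L
∑-one zero    = refl
∑-one (suc L) = cong suc (∑-one L)

∑-last : ∀ L (f : ℕ → ℕ) → ∑[ k < suc L ] f k ≡ ∑[ k < L ] f k + f L
∑-last zero    f = +-comm (f 0) 0
∑-last (suc L) f = trans (cong (f 0 +_) (∑-last L (λ k → f (suc k)))) (sym (+-assoc (f 0) _ _))

∑-reverse : ∀ L (f : ℕ → ℕ) → ∑[ k < L ] f (L ∸ suc k) ≡ ∑[ k < L ] f k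
∑-reverse zero    f = refl
∑-reverse (suc L) f =
  trans (cong (f L +_) (∑-reverse L f)) (trans (+-comm (f L) _) (sym (∑-last L f)))

∑-telescope : ∀ L (f g h : ℕ → ℕ) → (∀ k → k < L → f k + g k ≡ h k + g (suc k)) →
              ∑[ k < L ] f k + g 0 ≡ ∑[ k < L ] h k + g L
∑-telescope zero    f g h step = refl
∑-telescope (suc L) f g h step = begin
  f 0 + F + g 0        ≡⟨ xy∙z≈y∙xz (f 0) F (g 0) ⟩
  F + (f 0 + g 0)      ≡⟨ cong (F +_) (step 0 (s≤s z≤n)) ⟩
  F + (h 0 + g 1)      ≡⟨ x∙yz≈y∙xz F (h 0) (g 1) ⟩
  h 0 + (F + g 1)      ≡⟨ cong (h 0 +_) (∑-telescope L f′ g′ h′ (λ k k<L → step (suc k) (s≤s k<L))) ⟩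
  h 0 + (H + g (suc L)) ≡⟨ sym (+-assoc (h 0) H (g (suc L))) ⟩
  h 0 + H + g (suc L)  ∎
  where
  open ≡-Reasoning
  f′ g′ h′ : ℕ → ℕ
  f′ k = f (suc k)
  g′ k = g (suc k)
  h′ k = h (suc k)
  F H : ℕ
  F = ∑[ k < L ] f′ k
  H = ∑[ k < L ] h′ k

indexOf : List ℕ → ℕ → ℕ
indexOf []       x = 0
indexOf (a ∷ as) x = if ⌊ a ≟ x ⌋ then 0 else suc (indexOf as x)

elemAt : List ℕ → ℕ → ℕ
elemAt []       t       = 0
elemAt (a ∷ as) zero    = a
elemAt (a ∷ as) (suc t) = elemAt as t

indexOf-< : ∀ {x} l → x ∈ l → indexOf l x < length l
indexOf-< {x} (a ∷ as) x∈l with a ≟ x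
... | yes _ = s≤s z≤n
indexOf-< {x} (a ∷ as) (here refl)  | no a≢x = ⊥-elim (a≢x refl)
indexOf-< {x} (a ∷ as) (there x∈as) | no _   = s≤s (indexOf-< as x∈as)

elemAt-indexOf : ∀ {x} l → x ∈ l → elemAt l (indexOf l x) ≡ x
elemAt-indexOf {x} (a ∷ as) x∈l with a ≟ x
... | yes a≡x = a≡x
elemAt-indexOf {x} (a ∷ as) (here refl)  | no a≢x = ⊥-elim (a≢x refl)
elemAt-indexOf {x} (a ∷ as) (there x∈as) | no _   = elemAt-indexOf as x∈as

indexOf-injective : ∀ {x y} l → x ∈ l → y ∈ l → indexOf l x ≡ indexOf l y → x ≡ y
indexOf-injective l x∈l y∈l eq =
  trans (sym (elemAt-indexOf l x∈l)) (trans (cong (elemAt l) eq) (elemAt-indexOf l y∈l))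

elemAt-∈ : ∀ l {t} → t < length l → elemAt l t ∈ l
elemAt-∈ (a ∷ as) {zero}  _         = here refl
elemAt-∈ (a ∷ as) {suc t} (s≤s t<n) = there (elemAt-∈ as t<n)

indexOf-elemAt : ∀ l {t} → Unique l → t < length l → indexOf l (elemAt l t) ≡ t
indexOf-elemAt (a ∷ as) {zero} _ _ with a ≟ a
... | yes _   = refl
... | no a≢a = ⊥-elim (a≢a refl)
indexOf-elemAt (a ∷ as) {suc t} (a∉as ∷ as-unique) (s≤s t<n) with a ≟ elemAt as t
... | yes a≡at = ⊥-elim (All.lookup a∉as (elemAt-∈ as t<n) a≡at)
... | no _     = cong suc (indexOf-elemAt as as-unique t<n)

γ-indexOf : ∀ {x y} w → x ∈ w → y ∈ w → x ≢ y → γ x y w ≡ 𝟙[ indexOf w y < indexOf w x ]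
γ-indexOf {x} {y} (a ∷ as) x∈w y∈w x≢y with a ≟ y | a ≟ x
... | yes refl | yes refl = ⊥-elim (x≢y refl)
... | yes refl | no a≢x with x ∈? as
...   | yes _    = refl
...   | no x∉as  = ⊥-elim (x∉as (tail (a≢x ∘ sym) x∈w))
γ-indexOf (a ∷ as) x∈w y∈w x≢y | no a≢y | yes refl = refl
γ-indexOf (a ∷ as) (here refl) _ _ | no _ | no a≢x = ⊥-elim (a≢x refl)
γ-indexOf (a ∷ as) (there _) (here refl) _ | no a≢y | no _ = ⊥-elim (a≢y refl)
γ-indexOf (a ∷ as) (there x∈as) (there y∈as) x≢y | no _ | no _ = γ-indexOf as x∈as y∈as x≢y

nextAfter-elemAt : ∀ h {x} l → x ∈ l → suc (indexOf l x) < length l →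
                   nextAfter h l x ≡ elemAt l (suc (indexOf l x))
nextAfter-elemAt h {x} (a ∷ []) x∈l (s≤s 1+i<1) with a ≟ x
... | yes _ = ⊥-elim (1+n≰n 1+i<1)
nextAfter-elemAt h {x} (a ∷ []) (here refl) _ | no a≢x = ⊥-elim (a≢x refl)
nextAfter-elemAt h {x} (a ∷ b ∷ rest) x∈l 1+i<n with a ≟ x
... | yes _ = refl
nextAfter-elemAt h {x} (a ∷ b ∷ rest) (here refl) _ | no a≢x = ⊥-elim (a≢x refl)
nextAfter-elemAt h {x} (a ∷ b ∷ rest) (there x∈l) (s≤s 1+i<n) | no _ = nextAfter-elemAt h (b ∷ rest) x∈l 1+i<n

nextAfter-last : ∀ h {x} l → x ∈ l → suc (indexOf l x) ≡ length l → nextAfter h l x ≡ h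
nextAfter-last h {x} (a ∷ []) x∈l _ with a ≟ x
... | yes _ = refl
nextAfter-last h {x} (a ∷ []) (here refl) _ | no a≢x = ⊥-elim (a≢x refl)
nextAfter-last h {x} (a ∷ b ∷ rest) x∈l last with a ≟ x
... | yes _ = ⊥-elim (0≢1+n (suc-injective last))
nextAfter-last h {x} (a ∷ b ∷ rest) (here refl) _ | no a≢x = ⊥-elim (a≢x refl)
nextAfter-last h {x} (a ∷ b ∷ rest) (there x∈l) last | no _ = nextAfter-last h (b ∷ rest) x∈l (suc-injective last)

indexOf-cyc : ∀ {w x} → Unique w → x ∈ w → SuccMod (length w) (indexOf w x) (indexOf w (cyc w x))
indexOf-cyc {h ∷ tl} {x} unique x∈w with suc (indexOf (h ∷ tl) x) <? length (h ∷ tl)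
... | yes 1+i<n = inj₁ (1+i<n , trans (cong (indexOf (h ∷ tl)) (nextAfter-elemAt h (h ∷ tl) x∈w 1+i<n))
                                      (indexOf-elemAt (h ∷ tl) unique 1+i<n))
... | no 1+i≮n = inj₂ (last , trans (cong (indexOf (h ∷ tl)) (nextAfter-last h (h ∷ tl) x∈w last))
                                    (indexOf-elemAt (h ∷ tl) {0} unique (s≤s z≤n)))
  where
  last : suc (indexOf (h ∷ tl) x) ≡ length (h ∷ tl)
  last = ≤-antisym (indexOf-< (h ∷ tl) x∈w) (≮⇒≥ 1+i≮n)

cyc-elemAt : ∀ {w t} → Unique w → suc t < length w → cyc w (elemAt w t) ≡ elemAt w (suc t)
cyc-elemAt {h ∷ tl} {t} unique 1+t<n = begin
  nextAfter h (h ∷ tl) (elemAt (h ∷ tl) t)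
    ≡⟨ nextAfter-elemAt h (h ∷ tl) (elemAt-∈ (h ∷ tl) t<n) 1+i<n ⟩
  elemAt (h ∷ tl) (suc (indexOf (h ∷ tl) (elemAt (h ∷ tl) t)))
    ≡⟨ cong (λ i → elemAt (h ∷ tl) (suc i)) i≡t ⟩
  elemAt (h ∷ tl) (suc t) ∎
  where
  open ≡-Reasoning
  t<n : t < length (h ∷ tl)
  t<n = <-trans (n<1+n t) 1+t<n
  i≡t : indexOf (h ∷ tl) (elemAt (h ∷ tl) t) ≡ t
  i≡t = indexOf-elemAt (h ∷ tl) unique t<n
  1+i<n : suc (indexOf (h ∷ tl) (elemAt (h ∷ tl) t)) < length (h ∷ tl)
  1+i<n = subst (λ i → suc i < length (h ∷ tl)) (sym i≡t) 1+t<n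

∈-range⁺ : ∀ {n x} → 1 ≤ x → x ≤ n → x ∈ range n
∈-range⁺ {x = suc x} _ x≤n = ∈-map⁺ suc (∈-upTo⁺ x≤n)

∈-range⁻ : ∀ {n x} → x ∈ range n → 1 ≤ x × x ≤ n
∈-range⁻ x∈range with y , y∈upTo , refl ← ∈-map⁻ suc x∈range = s≤s z≤n , ∈-upTo⁻ y∈upTo

range-unique : ∀ n → Unique (range n)
range-unique n = Unique.map⁺ suc-injective (Unique.upTo⁺ n)

range-length : ∀ n → length (range n) ≡ n
range-length n = trans (length-map suc (upTo n)) (length-upTo n)

module _ {n w} (w-word : IsWord n w) where

  word-unique : Unique w
  word-unique = Permutation.Unique-resp-↭ (setoid ℕ) (↭⇒↭ₛ (↭-sym w-word)) (range-unique n)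

  word-length : length w ≡ n
  word-length = trans (↭-length w-word) (range-length n)

  word-∈ : ∀ {x} → 1 ≤ x → x ≤ n → x ∈ w
  word-∈ 1≤x x≤n = ∈-resp-↭ (↭-sym w-word) (∈-range⁺ 1≤x x≤n)

  word-∈⁻ : ∀ {x} → x ∈ w → 1 ≤ x × x ≤ n
  word-∈⁻ x∈w = ∈-range⁻ (∈-resp-↭ w-word x∈w)

  word-indexOf-< : ∀ {x} → x ∈ w → indexOf w x < n
  word-indexOf-< x∈w = subst (_ <_) word-length (indexOf-< w x∈w)

  word-elemAt-∈ : ∀ {t} → t < n → elemAt w t ∈ w
  word-elemAt-∈ t<n = elemAt-∈ w (subst (_ <_) (sym word-length) t<n)

  word-indexOf-cyc : ∀ {x} → x ∈ w → SuccMod n (indexOf w x) (indexOf w (cyc w x))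
  word-indexOf-cyc x∈w = subst (λ m → SuccMod m _ _) word-length (indexOf-cyc word-unique x∈w)

  word-cyc-elemAt : ∀ {t} → suc t < n → cyc w (elemAt w t) ≡ elemAt w (suc t)
  word-cyc-elemAt 1+t<n = cyc-elemAt word-unique (subst (_ <_) (sym word-length) 1+t<n)

∑-γ-w₀-reverse : ∀ {n i j} w → i ≤ j → j ≤ n →
  ∑[ k < j ∸ i ] γ (w₀ n (suc (i + k))) (w₀ n (i + k)) w ≡ ∑[ k < j ∸ i ] γ (w₀ n j + k) (suc (w₀ n j + k)) w
∑-γ-w₀-reverse {n} {i} {j} w i≤j j≤n =
  trans (∑-cong (j ∸ i) reflected-term) (∑-reverse (j ∸ i) (λ l → γ (w₀ n j + l) (suc (w₀ n j + l)) w))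
  where
  reflected-term : ∀ k → k < j ∸ i →
    γ (w₀ n (suc (i + k))) (w₀ n (i + k)) w ≡ γ (w₀ n j + (j ∸ i ∸ suc k)) (suc (w₀ n j + (j ∸ i ∸ suc k))) w
  reflected-term k k<L =
    trans (cong (λ y → γ (w₀ n (suc (i + k))) y w) (w₀-suc (≤-trans i+k≤j j≤n)))
          (cong (λ x → γ x (suc x) w) (w₀-shift i≤j j≤n k<L))
    where
    i+k≤j : i + k ≤ j
    i+k≤j = subst (i + k ≤_) (m+[n∸m]≡n i≤j) (+-monoʳ-≤ i (<⇒≤ k<L))

subtract-equations : ∀ {a b L m m′} → a + m ≡ L + m′ → b + m ≡ 1 + m′ → a + 1 ≡ L + b
subtract-equations {a} {b} {L} {m} {m′} e₁ e₂ = +-cancelʳ-≡ (m + m′) (a + 1) (L + b) (begin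
  a + 1 + (m + m′)        ≡⟨ interchange a 1 m m′ ⟩
  (a + m) + (1 + m′)      ≡⟨ cong₂ _+_ e₁ (sym e₂) ⟩
  (L + m′) + (b + m)      ≡⟨ interchange L m′ b m ⟩
  L + b + (m′ + m)        ≡⟨ cong (L + b +_) (+-comm m′ m) ⟩
  L + b + (m + m′)        ∎)
  where open ≡-Reasoning

open import Data.Integer as ℤ using (ℤ; +_; -_; _-_)
import Data.Integer.Properties as ℤ using (pos-+)
import Data.Integer.Tactic.RingSolver as ℤ using (solve-∀)

V-∑ : ∀ w i j → V w i j ≡ - (+ γ i j w) ℤ.+ + ∑[ k < j ∸ i ] γ (i + k) (suc (i + k)) w
V-∑ w i j = cong (λ s → - (+ γ i j w) ℤ.+ + s) (sum-interval (λ k → γ k (suc k) w) i j)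

complement-identity : ∀ i {j} L a a′ g g′ → i + L ≡ j → a′ + a + 1 ≡ L + (g′ + g) →
                      - (+ g′) ℤ.+ + a′ ≡ + j - + i - + 1 - (- (+ g) ℤ.+ + a)
complement-identity i L a a′ g g′ refl e = begin
  - (+ g′) ℤ.+ + a′                                   ≡⟨ split (+ a′) (+ a) (+ g′) ⟩
  (+ a′ ℤ.+ + a ℤ.+ + 1) - (+ a ℤ.+ + 1 ℤ.+ + g′)     ≡⟨ cong (_- (+ a ℤ.+ + 1 ℤ.+ + g′)) e-ℤ ⟩
  (+ L ℤ.+ (+ g′ ℤ.+ + g)) - (+ a ℤ.+ + 1 ℤ.+ + g′)   ≡⟨ merge (+ i) (+ L) (+ a) (+ g) (+ g′) ⟩
  (+ i ℤ.+ + L) - + i - + 1 - (- (+ g) ℤ.+ + a)        ≡⟨ cong (λ z → z - + i - + 1 - (- (+ g) ℤ.+ + a)) (ℤ.pos-+ i L) ⟨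
  + (i + L) - + i - + 1 - (- (+ g) ℤ.+ + a)            ∎
  where
  open ≡-Reasoning
  e-ℤ : + a′ ℤ.+ + a ℤ.+ + 1 ≡ + L ℤ.+ (+ g′ ℤ.+ + g)
  e-ℤ = begin
    + a′ ℤ.+ + a ℤ.+ + 1       ≡⟨ cong (ℤ._+ + 1) (ℤ.pos-+ a′ a) ⟨
    + (a′ + a) ℤ.+ + 1         ≡⟨ ℤ.pos-+ (a′ + a) 1 ⟨
    + (a′ + a + 1)             ≡⟨ cong +_ e ⟩
    + (L + (g′ + g))           ≡⟨ ℤ.pos-+ L (g′ + g) ⟩
    + L ℤ.+ + (g′ + g)         ≡⟨ cong (λ z → + L ℤ.+ z) (ℤ.pos-+ g′ g) ⟩
    + L ℤ.+ (+ g′ ℤ.+ + g)     ∎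
  split : ∀ A′ A G′ → - G′ ℤ.+ A′ ≡ (A′ ℤ.+ A ℤ.+ + 1) - (A ℤ.+ + 1 ℤ.+ G′)
  split = ℤ.solve-∀
  merge : ∀ I L A G G′ → (L ℤ.+ (G′ ℤ.+ G)) - (A ℤ.+ + 1 ℤ.+ G′) ≡ (I ℤ.+ L) - I - + 1 - (- G ℤ.+ A)
  merge = ℤ.solve-∀

module Inverse {n w w′} (w-word : IsWord n w) (w′-word : IsWord n w′)
               (w′∘w≗id : ∀ x → 1 ≤ x → x ≤ n → cyc w′ (cyc w x) ≡ x) where

  w⊆w′ : ∀ {x} → x ∈ w → x ∈ w′
  w⊆w′ = ∈-resp-↭ (↭-trans w-word (↭-sym w′-word))

  pos : ℕ → ℕ
  pos t = indexOf w′ (elemAt w t)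

  pos-SubMod : ∀ t → t < n → SubMod n (pos 0) t (pos t)
  pos-SubMod = SubMod-iterate pos pos-step
    where
    pos-step : ∀ t → suc t < n → SuccMod n (pos (suc t)) (pos t)
    pos-step t 1+t<n = subst (SuccMod n (pos (suc t))) (cong (indexOf w′) w′-back)
                             (word-indexOf-cyc w′-word (w⊆w′ (word-elemAt-∈ w-word 1+t<n)))
      where
      x∈w : elemAt w t ∈ w
      x∈w = word-elemAt-∈ w-word (<-trans (n<1+n t) 1+t<n)
      w′-back : cyc w′ (elemAt w (suc t)) ≡ elemAt w t
      w′-back = trans (cong (cyc w′) (sym (word-cyc-elemAt w-word 1+t<n)))
                      (w′∘w≗id _ (proj₁ (word-∈⁻ w-word x∈w)) (proj₂ (word-∈⁻ w-word x∈w)))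

  wrapped : ℕ → ℕ
  wrapped x = 𝟙[ pos 0 < indexOf w x ]

  γ-pair : ∀ {a b} → a ∈ w → b ∈ w → a ≢ b → γ a b w′ + γ a b w + wrapped b ≡ 1 + wrapped a
  γ-pair {a} {b} a∈w b∈w a≢b = begin
    γ a b w′ + γ a b w + wrapped b
      ≡⟨ cong₂ (λ x y → x + y + wrapped b) γ′-pos (γ-indexOf w a∈w b∈w a≢b) ⟩
    𝟙[ pos t < pos s ] + 𝟙[ t < s ] + wrapped b
      ≡⟨ SubMod-𝟙 s≢t s<n t<n (pos-SubMod s s<n) (pos-SubMod t t<n) ⟩
    1 + wrapped a ∎
    where
    open ≡-Reasoning
    s t : ℕ
    s = indexOf w a
    t = indexOf w b
    s<n : s < n
    s<n = word-indexOf-< w-word a∈w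
    t<n : t < n
    t<n = word-indexOf-< w-word b∈w
    s≢t : s ≢ t
    s≢t = a≢b ∘ indexOf-injective w a∈w b∈w
    γ′-pos : γ a b w′ ≡ 𝟙[ pos t < pos s ]
    γ′-pos = trans (γ-indexOf w′ (w⊆w′ a∈w) (w⊆w′ b∈w) a≢b)
                   (sym (cong₂ (λ x y → 𝟙[ indexOf w′ x < indexOf w′ y ])
                               (elemAt-indexOf w b∈w) (elemAt-indexOf w a∈w)))

  V-inverse : ∀ i j → InT n i j → V w′ i j ≡ + j - + i - + 1 - V w i j
  V-inverse i j (1≤i , i<j , j≤n) = begin
    V w′ i j                                  ≡⟨ V-∑ w′ i j ⟩
    - (+ γ i j w′) ℤ.+ + S′                   ≡⟨ complement-identity i L S S′ (γ i j w) (γ i j w′)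
                                                   (m+[n∸m]≡n i≤j) (subtract-equations telescoped ends) ⟩
    + j - + i - + 1 - (- (+ γ i j w) ℤ.+ + S) ≡⟨ cong (λ v → + j - + i - + 1 - v) (V-∑ w i j) ⟨
    + j - + i - + 1 - V w i j                 ∎
    where
    open ≡-Reasoning
    i≤j : i ≤ j
    i≤j = <⇒≤ i<j
    inv′ inv : ℕ → ℕ
    inv′ k = γ (i + k) (suc (i + k)) w′
    inv  k = γ (i + k) (suc (i + k)) w
    L S′ S : ℕ
    L = j ∸ i
    S′ = ∑[ k < L ] inv′ k
    S  = ∑[ k < L ] inv k
    ∈w : ∀ {x} → i ≤ x → x ≤ j → x ∈ w
    ∈w i≤x x≤j = word-∈ w-word (≤-trans 1≤i i≤x) (≤-trans x≤j j≤n)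
    step : ∀ k → k < L → 1 + wrapped (i + k) ≡ inv′ k + inv k + wrapped (i + suc k)
    step k k<L = sym (trans (cong (λ x → inv′ k + inv k + wrapped x) (+-suc i k))
                            (γ-pair (∈w (m≤m+n i k) (<⇒≤ i+k<j)) (∈w (≤-trans (m≤m+n i k) (n≤1+n _)) i+k<j)
                                    (<⇒≢ (n<1+n _))))
      where
      i+k<j : i + k < j
      i+k<j = subst (i + k <_) (m+[n∸m]≡n i≤j) (+-monoʳ-< i k<L)
    telescoped : S′ + S + wrapped j ≡ L + wrapped i
    telescoped = begin
      S′ + S + wrapped j                         ≡⟨ cong₂ _+_ (∑-distrib-+ L inv′ inv) (cong wrapped (m+[n∸m]≡n i≤j)) ⟨
      ∑[ k < L ] (inv′ k + inv k) + wrapped (i + L) ≡⟨ ∑-telescope L (λ _ → 1) (λ k → wrapped (i + k)) _ step ⟨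
      ∑[ k < L ] 1 + wrapped (i + 0)             ≡⟨ cong₂ _+_ (∑-one L) (cong wrapped (+-identityʳ i)) ⟩
      L + wrapped i                              ∎
    ends : γ i j w′ + γ i j w + wrapped j ≡ 1 + wrapped i
    ends = γ-pair (∈w ≤-refl i≤j) (∈w i≤j ≤-refl) (<⇒≢ i<j)

module ConjugationByW₀ {n w w′} (w-word : IsWord n w) (w′-word : IsWord n w′)
    (w′≗w₀∘w∘w₀ : ∀ x → 1 ≤ x → x ≤ n → cyc w′ x ≡ w₀ n (cyc w (w₀ n x))) where

  w₀-∈ : ∀ {v x} → IsWord n v → 1 ≤ x → x ≤ n → w₀ n x ∈ v
  w₀-∈ v-word 1≤x x≤n = word-∈ v-word (w₀-positive x≤n) (w₀-≤ 1≤x)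

  pos : ℕ → ℕ
  pos t = indexOf w′ (w₀ n (elemAt w t))

  pos-indexOf : ∀ {x} → 1 ≤ x → x ≤ n → pos (indexOf w (w₀ n x)) ≡ indexOf w′ x
  pos-indexOf 1≤x x≤n =
    cong (indexOf w′) (trans (cong (w₀ n) (elemAt-indexOf w (w₀-∈ w-word 1≤x x≤n))) (w₀-involutive x≤n))

  pos-AddMod : ∀ t → t < n → AddMod n (pos 0) t (pos t)
  pos-AddMod = AddMod-iterate pos pos-< pos-step
    where
    range-elemAt : ∀ {t} → t < n → 1 ≤ elemAt w t × elemAt w t ≤ n
    range-elemAt t<n = word-∈⁻ w-word (word-elemAt-∈ w-word t<n)
    pos-< : ∀ t → t < n → pos t < n
    pos-< t t<n = word-indexOf-< w′-word (w₀-∈ w′-word (proj₁ (range-elemAt t<n)) (proj₂ (range-elemAt t<n)))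
    pos-step : ∀ t → suc t < n → SuccMod n (pos t) (pos (suc t))
    pos-step t 1+t<n = subst (SuccMod n (pos t)) (cong (indexOf w′) w′-forward)
                             (word-indexOf-cyc w′-word (w₀-∈ w′-word 1≤x x≤n))
      where
      x : ℕ
      x = elemAt w t
      1≤x : 1 ≤ x
      1≤x = proj₁ (range-elemAt (<-trans (n<1+n t) 1+t<n))
      x≤n : x ≤ n
      x≤n = proj₂ (range-elemAt (<-trans (n<1+n t) 1+t<n))
      w′-forward : cyc w′ (w₀ n x) ≡ w₀ n (elemAt w (suc t))
      w′-forward = begin
        cyc w′ (w₀ n x)               ≡⟨ w′≗w₀∘w∘w₀ (w₀ n x) (w₀-positive x≤n) (w₀-≤ 1≤x) ⟩
        w₀ n (cyc w (w₀ n (w₀ n x)))  ≡⟨ cong (λ y → w₀ n (cyc w y)) (w₀-involutive x≤n) ⟩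
        w₀ n (cyc w x)                ≡⟨ cong (w₀ n) (word-cyc-elemAt w-word 1+t<n) ⟩
        w₀ n (elemAt w (suc t))       ∎
        where open ≡-Reasoning

  wrapped : ℕ → ℕ
  wrapped x = 𝟙[ n < suc (pos 0 + indexOf w (w₀ n x)) ]

  γ-pair : ∀ {a b} → 1 ≤ a → a ≤ n → 1 ≤ b → b ≤ n → a ≢ b →
           γ a b w′ + γ (w₀ n b) (w₀ n a) w + wrapped a ≡ 1 + wrapped b
  γ-pair {a} {b} 1≤a a≤n 1≤b b≤n a≢b = begin
    γ a b w′ + γ (w₀ n b) (w₀ n a) w + wrapped a ≡⟨ cong₂ (λ x y → x + y + wrapped a) γ′-pos γ-pos ⟩
    𝟙[ pos t < pos s ] + 𝟙[ s < t ] + wrapped a  ≡⟨ xy∙z≈xz∙y 𝟙[ pos t < pos s ] _ _ ⟩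
    𝟙[ pos t < pos s ] + wrapped a + 𝟙[ s < t ]
      ≡⟨ cong (_+ 𝟙[ s < t ]) (AddMod-𝟙 s<n t<n (pos-AddMod s s<n) (pos-AddMod t t<n)) ⟩
    𝟙[ t < s ] + wrapped b + 𝟙[ s < t ]          ≡⟨ xy∙z≈xz∙y 𝟙[ t < s ] _ _ ⟩
    𝟙[ t < s ] + 𝟙[ s < t ] + wrapped b          ≡⟨ cong (_+ wrapped b) (𝟙-trichotomy s≢t) ⟩
    1 + wrapped b                                ∎
    where
    open ≡-Reasoning
    w₀a∈w : w₀ n a ∈ w
    w₀a∈w = w₀-∈ w-word 1≤a a≤n
    w₀b∈w : w₀ n b ∈ w
    w₀b∈w = w₀-∈ w-word 1≤b b≤n
    s t : ℕ
    s = indexOf w (w₀ n a)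
    t = indexOf w (w₀ n b)
    s<n : s < n
    s<n = word-indexOf-< w-word w₀a∈w
    t<n : t < n
    t<n = word-indexOf-< w-word w₀b∈w
    s≢t : s ≢ t
    s≢t = a≢b ∘ w₀-injective a≤n b≤n ∘ indexOf-injective w w₀a∈w w₀b∈w
    γ′-pos : γ a b w′ ≡ 𝟙[ pos t < pos s ]
    γ′-pos = trans (γ-indexOf w′ (word-∈ w′-word 1≤a a≤n) (word-∈ w′-word 1≤b b≤n) a≢b)
                   (sym (cong₂ 𝟙[_<_] (pos-indexOf 1≤b b≤n) (pos-indexOf 1≤a a≤n)))
    γ-pos : γ (w₀ n b) (w₀ n a) w ≡ 𝟙[ s < t ]
    γ-pos = γ-indexOf w w₀b∈w w₀a∈w (s≢t ∘ sym ∘ cong (indexOf w))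

  V-conjugate : ∀ i j → InT n i j → V w′ i j ≡ + j - + i - + 1 - V w (w₀ n j) (w₀ n i)
  V-conjugate i j (1≤i , i<j , j≤n) = begin
    V w′ i j                                  ≡⟨ V-∑ w′ i j ⟩
    - (+ γ i j w′) ℤ.+ + S′                   ≡⟨ complement-identity i L R S′ (γ (w₀ n j) (w₀ n i) w) (γ i j w′)
                                                   (m+[n∸m]≡n i≤j) (subtract-equations telescoped ends) ⟩
    + j - + i - + 1 - (- (+ γ (w₀ n j) (w₀ n i) w) ℤ.+ + R)
                                              ≡⟨ cong (λ v → + j - + i - + 1 - v) V-reflected ⟨
    + j - + i - + 1 - V w (w₀ n j) (w₀ n i)  ∎
    where
    open ≡-Reasoning
    i≤j : i ≤ j
    i≤j = <⇒≤ i<j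
    inv′ inv : ℕ → ℕ
    inv′ k = γ (i + k) (suc (i + k)) w′
    inv  k = γ (w₀ n (suc (i + k))) (w₀ n (i + k)) w
    L S′ R : ℕ
    L = j ∸ i
    S′ = ∑[ k < L ] inv′ k
    R  = ∑[ k < L ] γ (w₀ n j + k) (suc (w₀ n j + k)) w
    V-reflected : V w (w₀ n j) (w₀ n i) ≡ - (+ γ (w₀ n j) (w₀ n i) w) ℤ.+ + R
    V-reflected = trans (V-∑ w (w₀ n j) (w₀ n i))
      (cong (λ l → - (+ γ (w₀ n j) (w₀ n i) w) ℤ.+ + ∑[ k < l ] γ (w₀ n j + k) (suc (w₀ n j + k)) w)
            (w₀-∸ i≤j j≤n))
    step : ∀ k → k < L → inv′ k + inv k + wrapped (i + k) ≡ 1 + wrapped (i + suc k)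
    step k k<L = trans (γ-pair (≤-trans 1≤i (m≤m+n i k)) (<⇒≤ i+k<n) (s≤s z≤n) i+k<n (<⇒≢ (n<1+n _)))
                       (cong (λ x → 1 + wrapped x) (sym (+-suc i k)))
      where
      i+k<n : i + k < n
      i+k<n = ≤-trans (subst (i + k <_) (m+[n∸m]≡n i≤j) (+-monoʳ-< i k<L)) j≤n
    telescoped : S′ + R + wrapped i ≡ L + wrapped j
    telescoped = begin
      S′ + R + wrapped i
        ≡⟨ cong₂ (λ r x → S′ + r + x) (∑-γ-w₀-reverse w i≤j j≤n) (cong wrapped (+-identityʳ i)) ⟨
      S′ + ∑[ k < L ] inv k + wrapped (i + 0)        ≡⟨ cong (_+ wrapped (i + 0)) (∑-distrib-+ L inv′ inv) ⟨
      ∑[ k < L ] (inv′ k + inv k) + wrapped (i + 0)  ≡⟨ ∑-telescope L _ (λ k → wrapped (i + k)) (λ _ → 1) step ⟩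
      ∑[ k < L ] 1 + wrapped (i + L)                 ≡⟨ cong₂ _+_ (∑-one L) (cong wrapped (m+[n∸m]≡n i≤j)) ⟩
      L + wrapped j                                  ∎
    ends : γ i j w′ + γ (w₀ n j) (w₀ n i) w + wrapped i ≡ 1 + wrapped j
    ends = γ-pair 1≤i (≤-trans i≤j j≤n) (≤-trans 1≤i i≤j) j≤n (<⇒≢ i<j)

corollary3p9 : (n : ℕ) → 2 ≤ n →
    ((w w' : _) → IsWord n w → IsWord n w' →
      (∀ x → 1 ≤ x → x ≤ n → (cyc w' (cyc w x) ≡ x) × (cyc w (cyc w' x) ≡ x)) →
      ∀ i j → InT n i j → V w' i j ≡ + j - + i - + 1 - V w i j)
    ×
    ((w w' : _) → IsWord n w → IsWord n w' →
      (∀ x → 1 ≤ x → x ≤ n → cyc w' x ≡ w₀ n (cyc w (w₀ n x))) →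
      ∀ i j → InT n i j → V w' i j ≡ + j - + i - + 1 - V w (w₀ n j) (w₀ n i))
    ×
    IsAntiAutomorphism n flipV
    ×
    IsAntiAutomorphism n (flipW₀ n)
corollary3p9 n _ =
  (λ w w′ w-word w′-word inverse →
     Inverse.V-inverse w-word w′-word (λ x 1≤x x≤n → proj₁ (inverse x 1≤x x≤n))) ,
  (λ w w′ w-word w′-word conjugate → ConjugationByW₀.V-conjugate w-word w′-word conjugate) ,
  flipV-isAntiAutomorphism n ,
  flipW₀-isAntiAutomorphism n
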